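{- Let $n=2m$ be an even positive integer and let $A,B,C,D$ be a Williamson sequence of order $n$. Let $A',B',C',D'$ be the $2$-compressions of $A,B,C,D$ respectively. Then $A'+B'+C'+D'\equiv[0,\dots,0]\pmod 4$, i.e., $a'_j+b'_j+c'_j+d'_j\equiv 0\pmod 4$ for every $j=0,\dots,m-1$.
   Context: A sequence $X=[x_0,\dots,x_{n-1}]$ is symmetric if $x_i=x_{n-i}$ for $1\le i<n$. The periodic autocorrelation function of $X$ is $\mathrm{PAF}_X(s)=\sum_{k=0}^{n-1}x_kx_{(k+s)\bmod n}$. Four symmetric sequences $A,B,C,D\in\{\pm1\}^n$ form a Williamson sequence of order $n$ if $\mathrm{PAF}_A(s)+\mathrm{PAF}_B(s)+\mathrm{PAF}_C(s)+\mathrm{PAF}_D(s)=0$ for $s=1,\dots,\lfloor n/2\rfloor$. For a sequence $X=[x_0,\dots,x_{n-1}]$ of length $n=dk$, its $k$-compression is the sequence $[x^{(d)}_0,\dots,x^{(d)}_{d-1}]$ with $x^{(d)}_j=x_j+x_{j+d}+\dots+x_{j+(k-1)d}$; in particular for $n=2m$ the $2$-compression $X'$ has length $m$ and entries $x'_j=x_j+x_{j+m}$, $0\le j<m$. -}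

module Defs where

open import Data.Nat as ℕ using (ℕ; zero; suc; NonZero)
open import Data.Nat.Properties using (m*n≢0)
open import Data.Nat.DivMod using (_%_; _/_; m%n<n)
open import Data.Fin using (Fin; toℕ; fromℕ<)
open import Data.Integer as ℤ using (ℤ; +_; -_)
open import Data.Sum using (_⊎_)
open import Data.Product using (_×_)
open import Relation.Binary.PropositionalEquality using (_≡_)

Seq : ℕ → Set
Seq n = Fin n → ℤ

idx : (n : ℕ) → .{{_ : NonZero n}} → ℕ → Fin n
idx n k = fromℕ< (m%n<n k n)

at : {n : ℕ} → .{{_ : NonZero n}} → Seq n → ℕ → ℤ
at {n} X k = X (idx n k)

IsPM1 : {n : ℕ} → Seq n → Set
IsPM1 X = ∀ i → X i ≡ + 1 ⊎ X i ≡ - (+ 1)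

Symmetric : {n : ℕ} → .{{_ : NonZero n}} → Seq n → Set
Symmetric {n} X = ∀ (i : Fin n) → 1 ℕ.≤ toℕ i → X i ≡ at X (n ℕ.∸ toℕ i)

sumTo : ℕ → (ℕ → ℤ) → ℤ
sumTo zero f = + 0
sumTo (suc n) f = sumTo n f ℤ.+ f n

PAF : {n : ℕ} → .{{_ : NonZero n}} → Seq n → ℕ → ℤ
PAF {n} X s = sumTo n (λ k → at X k ℤ.* at X (k ℕ.+ s))

IsWilliamson : (n : ℕ) → .{{_ : NonZero n}} → Seq n → Seq n → Seq n → Seq n → Set
IsWilliamson n A B C D =
  (IsPM1 A × IsPM1 B × IsPM1 C × IsPM1 D) ×
  (Symmetric A × Symmetric B × Symmetric C × Symmetric D) ×
  (∀ s → 1 ℕ.≤ s → s ℕ.≤ n / 2 →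
     PAF A s ℤ.+ PAF B s ℤ.+ PAF C s ℤ.+ PAF D s ≡ + 0)

compress2 : (m : ℕ) → .{{_ : NonZero m}} → Seq (2 ℕ.* m) → Seq m
compress2 m X j = at X (toℕ j) ℤ.+ at X (toℕ j ℕ.+ m)
  where instance
    nz2m : NonZero (2 ℕ.* m)
    nz2m = m*n≢0 2 m

-- Write each ±1 entry as x = 1 − 2y with y ∈ {0,1} marking the −1 entries. Then
-- PAF_X(s) = n − 4 Σ_j y_j + 4 C_X(s) with C_X(s) = Σ_j y_j y_{j+s}, so the Williamson
-- equations say that Σ_X C_X(s) = Σ_X Σ_j y_j − n for 1 ≤ s ≤ m, summing over X ∈ {A,B,C,D}.
-- As X is symmetric, the involution j ↦ −s − j (mod n) preserves the terms of C_X(s).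
-- For s = 1 it has no fixed point, so C_X(1) is even and hence so is Σ_X Σ_j y_j;
-- for s = 2t its fixed points −t and m − t give C_X(2t) ≡ y_t + y_{t+m} (mod 2).
-- So among the eight entries a_t, a_{t+m}, …, d_{t+m} an even number equal −1 when
-- 2t ≤ m (for t = 0 because C_X(0) = Σ_j y_j), and for the remaining t by the symmetry
-- y_t = y_{n−t}. Since x′_t = 2 − 2(y_t + y_{t+m}), the sum of the four compressions is
-- 8 − 2·(an even number).

module Submission where

open import Defs

module WilliamsonParity where

  open import Function using (_∘_; _$_)
  open import Data.Nat as ℕ using (ℕ; zero; suc; NonZero; z≤n; s≤s)
  import Data.Nat.Properties as ℕₚ
  import Data.Nat.Tactic.RingSolver as ℕ-Solver
  open import Data.Nat.DivMod using (_%_; _/_; m%n<n; [m+kn]%n≡m%n; m≡m%n+[m/n]*n; n%n≡0; m*n/n≡m)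
  open import Data.Fin using (Fin; toℕ; fromℕ<)
  open import Data.Fin.Properties using (fromℕ<-cong; toℕ-fromℕ<; toℕ<n)
  open import Data.Integer using (ℤ; +_; -[1+_]; _+_; _*_; _-_)
  open import Data.Integer.Properties
  open import Data.Integer.Divisibility.Signed
  open import Data.Integer.Tactic.RingSolver using (solve-∀; solve)
  open import Data.List using (_∷_; [])
  open import Data.Product using (_,_; proj₂)
  open import Data.Sum using (inj₁; inj₂)
  open import Relation.Binary.PropositionalEquality
  open import Relation.Nullary using (yes; no)

  sumTo-cong : ∀ n {f g : ℕ → ℤ} → (∀ k → f k ≡ g k) → sumTo n f ≡ sumTo n g
  sumTo-cong zero    f≗g = refl
  sumTo-cong (suc n) f≗g = cong₂ _+_ (sumTo-cong n f≗g) (f≗g n)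

  sumTo-+ : ∀ n (f g : ℕ → ℤ) → sumTo n (λ k → f k + g k) ≡ sumTo n f + sumTo n g
  sumTo-+ zero    f g = refl
  sumTo-+ (suc n) f g rewrite sumTo-+ n f g = medial (sumTo n f) (sumTo n g) (f n) (g n)
    where
    medial : ∀ a b c d → a + b + (c + d) ≡ a + c + (b + d)
    medial = solve-∀

  sumTo-*ˡ : ∀ n c (f : ℕ → ℤ) → sumTo n (λ k → c * f k) ≡ c * sumTo n f
  sumTo-*ˡ zero    c f = sym (*-zeroʳ c)
  sumTo-*ˡ (suc n) c f rewrite sumTo-*ˡ n c f = sym (*-distribˡ-+ c (sumTo n f) (f n))

  sumTo-const : ∀ n c → sumTo n (λ _ → c) ≡ + n * c
  sumTo-const zero    c = sym (*-zeroˡ c)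
  sumTo-const (suc n) c rewrite sumTo-const n c = trans (+-comm (+ n * c) c) (sym (suc-* (+ n) c))

  sumTo-split : ∀ a b (f : ℕ → ℤ) → sumTo (a ℕ.+ b) f ≡ sumTo a f + sumTo b (λ v → f (a ℕ.+ v))
  sumTo-split a zero    f rewrite ℕₚ.+-identityʳ a = sym (+-identityʳ _)
  sumTo-split a (suc b) f rewrite ℕₚ.+-suc a b | sumTo-split a b f = +-assoc (sumTo a f) _ _

  sumTo-sucˡ : ∀ n (f : ℕ → ℤ) → sumTo (suc n) f ≡ f 0 + sumTo n (f ∘ suc)
  sumTo-sucˡ zero    f = trans (+-identityˡ (f 0)) (sym (+-identityʳ (f 0)))
  sumTo-sucˡ (suc n) f rewrite sumTo-sucˡ n f = +-assoc (f 0) _ _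

  sumTo-reverse : ∀ n (f g : ℕ → ℤ) → (∀ v w → suc (v ℕ.+ w) ≡ n → f v ≡ g w) →
                  sumTo n f ≡ sumTo n g
  sumTo-reverse zero    f g f≗g = refl
  sumTo-reverse (suc n) f g f≗g = begin
    sumTo n f + f n                  ≡⟨ cong₂ _+_ (sumTo-reverse n f (g ∘ suc) inner) (f≗g n 0 last) ⟩
    sumTo n (g ∘ suc) + g 0          ≡⟨ +-comm _ (g 0) ⟩
    g 0 + sumTo n (g ∘ suc)          ≡⟨ sumTo-sucˡ n g ⟨
    sumTo (suc n) g                  ∎
    where
    open ≡-Reasoning
    inner : ∀ v w → suc (v ℕ.+ w) ≡ n → f v ≡ g (suc w)
    inner v w eq = f≗g v (suc w) (cong suc (trans (ℕₚ.+-suc v w) eq))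
    last : suc (n ℕ.+ 0) ≡ suc n
    last = cong suc (ℕₚ.+-identityʳ n)

  sumTo-rotate : ∀ n (h : ℕ → ℤ) → (∀ k → h (n ℕ.+ k) ≡ h k) →
                 ∀ c → sumTo n (λ k → h (c ℕ.+ k)) ≡ sumTo n h
  sumTo-rotate n h h-periodic zero    = refl
  sumTo-rotate n h h-periodic (suc c) = begin
    sumTo n (λ k → h (suc c ℕ.+ k))  ≡⟨ sumTo-cong n (λ k → cong h (sym (ℕₚ.+-suc c k))) ⟩
    sumTo n (λ k → h (c ℕ.+ suc k))  ≡⟨ rotate-by-one n (λ k → h (c ℕ.+ k)) wraps ⟩
    sumTo n (λ k → h (c ℕ.+ k))      ≡⟨ sumTo-rotate n h h-periodic c ⟩
    sumTo n h                        ∎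
    where
    open ≡-Reasoning
    wraps : h (c ℕ.+ n) ≡ h (c ℕ.+ 0)
    wraps = trans (cong h (ℕₚ.+-comm c n)) (trans (h-periodic c) (cong h (sym (ℕₚ.+-identityʳ c))))
    rotate-by-one : ∀ l (g : ℕ → ℤ) → g l ≡ g 0 → sumTo l (g ∘ suc) ≡ sumTo l g
    rotate-by-one zero    g _    = refl
    rotate-by-one (suc l) g g-wraps = begin
      sumTo l (g ∘ suc) + g (suc l)   ≡⟨ +-comm _ (g (suc l)) ⟩
      g (suc l) + sumTo l (g ∘ suc)   ≡⟨ cong (_+ sumTo l (g ∘ suc)) g-wraps ⟩
      g 0 + sumTo l (g ∘ suc)         ≡⟨ sumTo-sucˡ l g ⟨
      sumTo (suc l) g                 ∎

  sumTo-halves : ∀ m (g : ℕ → ℤ) → sumTo (2 ℕ.* m) g ≡ sumTo m g + sumTo m (λ v → g (m ℕ.+ v))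
  sumTo-halves m g = trans (cong (λ l → sumTo (m ℕ.+ l) g) (ℕₚ.+-identityʳ m)) (sumTo-split m m g)

  sumTo-palindrome : ∀ m (g : ℕ → ℤ) → (∀ i j → suc (i ℕ.+ j) ≡ 2 ℕ.* m → g i ≡ g j) →
                     sumTo (2 ℕ.* m) g ≡ + 2 * sumTo m g
  sumTo-palindrome m g g-palindrome = begin
    sumTo (2 ℕ.* m) g                            ≡⟨ sumTo-halves m g ⟩
    sumTo m g + sumTo m (λ v → g (m ℕ.+ v))      ≡⟨ cong (λ s → sumTo m g + s) (sumTo-reverse m _ g upper≗lower) ⟩
    sumTo m g + sumTo m g                        ≡⟨ a+a≡2a (sumTo m g) ⟩
    + 2 * sumTo m g                              ∎
    where
    open ≡-Reasoning
    a+a≡2a : ∀ a → a + a ≡ + 2 * a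
    a+a≡2a = solve-∀
    upper≗lower : ∀ v w → suc (v ℕ.+ w) ≡ m → g (m ℕ.+ v) ≡ g w
    upper≗lower v w eq = g-palindrome (m ℕ.+ v) w (begin
      suc (m ℕ.+ v ℕ.+ w)  ≡⟨ ℕ-Solver.solve (m ∷ v ∷ w ∷ []) ⟩
      m ℕ.+ suc (v ℕ.+ w)  ≡⟨ cong (m ℕ.+_) eq ⟩
      m ℕ.+ m              ≡⟨ ℕ-Solver.solve (m ∷ []) ⟩
      2 ℕ.* m              ∎)

  sumTo-mirror : ∀ m (g : ℕ → ℤ) → (∀ i j → i ℕ.+ j ≡ 2 ℕ.* m → g i ≡ g j) →
                 sumTo (2 ℕ.* m) g + g 0 ≡ + 2 * sumTo m g + g m
  sumTo-mirror m g g-mirror = begin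
    sumTo (2 ℕ.* m) g + g 0                             ≡⟨ cong (_+ g 0) (sumTo-halves m g) ⟩
    sumTo m g + sumTo m (λ v → g (m ℕ.+ v)) + g 0       ≡⟨ cong (λ s → sumTo m g + s + g 0) (sumTo-reverse m _ (g ∘ suc) upper≗lower) ⟩
    sumTo m g + sumTo m (g ∘ suc) + g 0                 ≡⟨ rearrange (sumTo m g) _ (g 0) ⟩
    sumTo m g + (g 0 + sumTo m (g ∘ suc))               ≡⟨ cong (λ s → sumTo m g + s) (sumTo-sucˡ m g) ⟨
    sumTo m g + (sumTo m g + g m)                       ≡⟨ regroup (sumTo m g) (g m) ⟩
    + 2 * sumTo m g + g m                               ∎
    where
    open ≡-Reasoning
    rearrange : ∀ a b c → a + b + c ≡ a + (c + b)
    rearrange = solve-∀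
    regroup : ∀ a b → a + (a + b) ≡ + 2 * a + b
    regroup = solve-∀
    upper≗lower : ∀ v w → suc (v ℕ.+ w) ≡ m → g (m ℕ.+ v) ≡ g (suc w)
    upper≗lower v w eq = g-mirror (m ℕ.+ v) (suc w) (begin
      m ℕ.+ v ℕ.+ suc w    ≡⟨ ℕ-Solver.solve (m ∷ v ∷ w ∷ []) ⟩
      m ℕ.+ suc (v ℕ.+ w)  ≡⟨ cong (m ℕ.+_) eq ⟩
      m ℕ.+ m              ≡⟨ ℕ-Solver.solve (m ∷ []) ⟩
      2 ℕ.* m              ∎)

  negBit : ℤ → ℤ
  negBit (+ _)    = + 0
  negBit -[1+ _ ] = + 1

  negBit-idem : ∀ z → negBit z * negBit z ≡ negBit z
  negBit-idem (+ _)    = refl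
  negBit-idem -[1+ _ ] = refl

  module _ {n : ℕ} .{{_ : NonZero n}} (X : Seq n) where

    at-cong-% : ∀ {a b} → a % n ≡ b % n → at X a ≡ at X b
    at-cong-% {a} {b} eq = cong X (fromℕ<-cong (a % n) (b % n) eq (m%n<n a n) (m%n<n b n))

    at-periodic : ∀ a q → at X (a ℕ.+ q ℕ.* n) ≡ at X a
    at-periodic a q = at-cong-% ([m+kn]%n≡m%n a q n)

    at-mirror : Symmetric X → ∀ b → at X b ≡ at X (n ℕ.∸ b % n)
    at-mirror X-sym b with b % n ℕ.≟ 0
    ... | yes r≡0 = trans (at-cong-% (trans r≡0 (sym (n%n≡0 n)))) (cong (λ r → at X (n ℕ.∸ r)) (sym r≡0))
    ... | no  r≢0 = trans (X-sym i 1≤i) (cong (λ r → at X (n ℕ.∸ r)) (toℕ-fromℕ< (m%n<n b n)))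
      where
      i : Fin n
      i = fromℕ< (m%n<n b n)
      1≤i : 1 ℕ.≤ toℕ i
      1≤i rewrite toℕ-fromℕ< (m%n<n b n) = ℕₚ.n≢0⇒n>0 r≢0

    at-reflect : Symmetric X → ∀ q {a b} → a ℕ.+ b ≡ q ℕ.* n → at X a ≡ at X b
    at-reflect X-sym q {a} {b} a+b≡qn = begin
      at X a                               ≡⟨ at-periodic a (suc d) ⟨
      at X (a ℕ.+ suc d ℕ.* n)             ≡⟨ cong (at X) shift ⟨
      at X (n ℕ.∸ r ℕ.+ q ℕ.* n)           ≡⟨ at-periodic (n ℕ.∸ r) q ⟩
      at X (n ℕ.∸ r)                       ≡⟨ at-mirror X-sym b ⟨
      at X b                               ∎
      where
      open ≡-Reasoning
      r d : ℕ
      r = b % n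
      d = b / n
      regroup : ∀ p a r e → p ℕ.+ (a ℕ.+ (r ℕ.+ e)) ≡ a ℕ.+ (p ℕ.+ r) ℕ.+ e
      regroup = ℕ-Solver.solve-∀
      shift : n ℕ.∸ r ℕ.+ q ℕ.* n ≡ a ℕ.+ suc d ℕ.* n
      shift = begin
        n ℕ.∸ r ℕ.+ q ℕ.* n                  ≡⟨ cong (n ℕ.∸ r ℕ.+_) (sym a+b≡qn) ⟩
        n ℕ.∸ r ℕ.+ (a ℕ.+ b)                ≡⟨ cong (λ l → n ℕ.∸ r ℕ.+ (a ℕ.+ l)) (m≡m%n+[m/n]*n b n) ⟩
        n ℕ.∸ r ℕ.+ (a ℕ.+ (r ℕ.+ d ℕ.* n))  ≡⟨ regroup (n ℕ.∸ r) a r (d ℕ.* n) ⟩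
        a ℕ.+ (n ℕ.∸ r ℕ.+ r) ℕ.+ d ℕ.* n    ≡⟨ cong (λ l → a ℕ.+ l ℕ.+ d ℕ.* n) (ℕₚ.m∸n+n≡m (ℕₚ.<⇒≤ (m%n<n b n))) ⟩
        a ℕ.+ n ℕ.+ d ℕ.* n                  ≡⟨ ℕₚ.+-assoc a n (d ℕ.* n) ⟩
        a ℕ.+ suc d ℕ.* n                    ∎

    neg : ℕ → ℤ
    neg j = negBit (at X j)

    negCount : ℤ
    negCount = sumTo n neg

    negCorr : ℕ → ℤ
    negCorr s = sumTo n (λ j → neg j * neg (j ℕ.+ s))

    neg-periodic : ∀ q {a b} → a ≡ b ℕ.+ q ℕ.* n → neg a ≡ neg b
    neg-periodic q {b = b} refl = cong negBit (at-periodic b q)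

    neg-n+ : ∀ j → neg (n ℕ.+ j) ≡ neg j
    neg-n+ j = neg-periodic 1 (ℕ-Solver.solve (n ∷ j ∷ []))

    neg-reflect : Symmetric X → ∀ q {a b} → a ℕ.+ b ≡ q ℕ.* n → neg a ≡ neg b
    neg-reflect X-sym q eq = cong negBit (at-reflect X-sym q eq)

    neg-idem : ∀ j → neg j * neg j ≡ neg j
    neg-idem j = negBit-idem (at X j)

    at≡1-2neg : IsPM1 X → ∀ j → at X j ≡ + 1 - + 2 * neg j
    at≡1-2neg X-pm j with X-pm (idx n j)
    ... | inj₁ x≡1  rewrite x≡1  = refl
    ... | inj₂ x≡-1 rewrite x≡-1 = refl

    sumTo-neg-shift : ∀ s → sumTo n (λ j → neg (j ℕ.+ s)) ≡ negCount
    sumTo-neg-shift s = trans (sumTo-cong n (λ j → cong neg (ℕₚ.+-comm j s))) (sumTo-rotate n neg neg-n+ s)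

    negCorr-0 : negCorr 0 ≡ negCount
    negCorr-0 = sumTo-cong n (λ j → trans (cong (λ l → neg j * neg l) (ℕₚ.+-identityʳ j)) (neg-idem j))

    PAF-via-negCorr : IsPM1 X → ∀ s → PAF X s + + 4 * negCount ≡ + n + + 4 * negCorr s
    PAF-via-negCorr X-pm s = begin
      PAF X s + + 4 * negCount
        ≡⟨ cong (λ z → PAF X s + z) (four≡2*double negCount) ⟩
      PAF X s + + 2 * (negCount + negCount)
        ≡⟨ cong (λ z → PAF X s + + 2 * (negCount + z)) (sumTo-neg-shift s) ⟨
      PAF X s + + 2 * (negCount + sumTo n (λ j → neg (j ℕ.+ s)))
        ≡⟨ cong (λ z → PAF X s + z) (sym (trans (sumTo-*ˡ n (+ 2) _) (cong (+ 2 *_) (sumTo-+ n neg _)))) ⟩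
      PAF X s + sumTo n (λ j → + 2 * (neg j + neg (j ℕ.+ s)))
        ≡⟨ sumTo-+ n _ _ ⟨
      sumTo n (λ j → at X j * at X (j ℕ.+ s) + + 2 * (neg j + neg (j ℕ.+ s)))
        ≡⟨ sumTo-cong n pointwise ⟩
      sumTo n (λ j → + 1 + + 4 * (neg j * neg (j ℕ.+ s)))
        ≡⟨ sumTo-+ n _ _ ⟩
      sumTo n (λ _ → + 1) + sumTo n (λ j → + 4 * (neg j * neg (j ℕ.+ s)))
        ≡⟨ cong₂ _+_ (trans (sumTo-const n (+ 1)) (*-identityʳ (+ n))) (sumTo-*ˡ n (+ 4) _) ⟩
      + n + + 4 * negCorr s
        ∎
      where
      open ≡-Reasoning
      four≡2*double : ∀ a → + 4 * a ≡ + 2 * (a + a)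
      four≡2*double = solve-∀
      pm-product : ∀ a b → (+ 1 - + 2 * a) * (+ 1 - + 2 * b) + + 2 * (a + b) ≡ + 1 + + 4 * (a * b)
      pm-product = solve-∀
      pointwise : ∀ j → at X j * at X (j ℕ.+ s) + + 2 * (neg j + neg (j ℕ.+ s)) ≡ + 1 + + 4 * (neg j * neg (j ℕ.+ s))
      pointwise j = trans (cong₂ (λ x x′ → x * x′ + + 2 * (neg j + neg (j ℕ.+ s))) (at≡1-2neg X-pm j) (at≡1-2neg X-pm (j ℕ.+ s)))
                          (pm-product (neg j) (neg (j ℕ.+ s)))

  c+a≡2p+b⇒2∣c-[a+b] : ∀ c a b p → c + a ≡ + 2 * p + b → + 2 ∣ c - (a + b)
  c+a≡2p+b⇒2∣c-[a+b] c a b p eq = divides (p - a) $ begin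
    c - (a + b)                ≡⟨ solve (c ∷ a ∷ b ∷ []) ⟩
    c + a - (a + a + b)        ≡⟨ cong (_- (a + a + b)) eq ⟩
    + 2 * p + b - (a + a + b)  ≡⟨ solve (p ∷ a ∷ b ∷ []) ⟩
    (p - a) * + 2              ∎
    where open ≡-Reasoning

  instance
    2*-nonZero : ∀ {m} .{{_ : NonZero m}} → NonZero (2 ℕ.* m)
    2*-nonZero {m} = ℕₚ.m*n≢0 2 m

  negPair : ∀ m .{{_ : NonZero m}} → Seq (2 ℕ.* m) → ℕ → ℤ
  negPair m X t = neg X t + neg X (t ℕ.+ m)

  compress2-via-negPair : ∀ {m} .{{_ : NonZero m}} (X : Seq (2 ℕ.* m)) → IsPM1 X →
                          ∀ j → compress2 m X j ≡ + 2 - + 2 * negPair m X (toℕ j)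
  compress2-via-negPair {m} X X-pm j =
    trans (cong₂ _+_ (at≡1-2neg X X-pm (toℕ j)) (at≡1-2neg X X-pm (toℕ j ℕ.+ m)))
          (pm-sum (neg X (toℕ j)) (neg X (toℕ j ℕ.+ m)))
    where
    pm-sum : ∀ a b → + 1 - + 2 * a + (+ 1 - + 2 * b) ≡ + 2 - + 2 * (a + b)
    pm-sum = solve-∀

  module _ {m : ℕ} .{{_ : NonZero m}} (X : Seq (2 ℕ.* m)) (X-sym : Symmetric X) where

    private
      y : ℕ → ℤ
      y = neg X

    negPair-reflect : ∀ {u t} → u ℕ.+ t ≡ m → negPair m X u ≡ negPair m X t
    negPair-reflect {u} {t} u+t≡m =
      trans (cong₂ _+_ (neg-reflect X X-sym 1 u+[t+m]) (neg-reflect X X-sym 1 [u+m]+t)) (+-comm (y (t ℕ.+ m)) (y t))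
      where
      open ≡-Reasoning
      u+[t+m] : u ℕ.+ (t ℕ.+ m) ≡ 1 ℕ.* (2 ℕ.* m)
      u+[t+m] = begin
        u ℕ.+ (t ℕ.+ m)  ≡⟨ ℕₚ.+-assoc u t m ⟨
        u ℕ.+ t ℕ.+ m    ≡⟨ cong (ℕ._+ m) u+t≡m ⟩
        m ℕ.+ m          ≡⟨ ℕ-Solver.solve (m ∷ []) ⟩
        1 ℕ.* (2 ℕ.* m)  ∎
      [u+m]+t : u ℕ.+ m ℕ.+ t ≡ 1 ℕ.* (2 ℕ.* m)
      [u+m]+t = begin
        u ℕ.+ m ℕ.+ t    ≡⟨ ℕ-Solver.solve (u ∷ m ∷ t ∷ []) ⟩
        u ℕ.+ (t ℕ.+ m)  ≡⟨ u+[t+m] ⟩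
        1 ℕ.* (2 ℕ.* m)  ∎

    negCorr-1-even : + 2 ∣ negCorr X 1
    negCorr-1-even = subst (+ 2 ∣_) (sym (sumTo-palindrome m h h-palindrome)) (∣m⇒∣m*n (sumTo m h) ∣-refl)
      where
      h : ℕ → ℤ
      h j = y j * y (j ℕ.+ 1)
      h-palindrome : ∀ i j → suc (i ℕ.+ j) ≡ 2 ℕ.* m → h i ≡ h j
      h-palindrome i j eq =
        trans (cong₂ _*_ (neg-reflect X X-sym 1 i+[j+1]) (neg-reflect X X-sym 1 [i+1]+j)) (*-comm (y (j ℕ.+ 1)) (y j))
        where
        open ≡-Reasoning
        i+[j+1] : i ℕ.+ (j ℕ.+ 1) ≡ 1 ℕ.* (2 ℕ.* m)
        i+[j+1] = begin
          i ℕ.+ (j ℕ.+ 1)  ≡⟨ ℕ-Solver.solve (i ∷ j ∷ []) ⟩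
          suc (i ℕ.+ j)    ≡⟨ eq ⟩
          2 ℕ.* m          ≡⟨ ℕₚ.*-identityˡ (2 ℕ.* m) ⟨
          1 ℕ.* (2 ℕ.* m)  ∎
        [i+1]+j : i ℕ.+ 1 ℕ.+ j ≡ 1 ℕ.* (2 ℕ.* m)
        [i+1]+j = begin
          i ℕ.+ 1 ℕ.+ j    ≡⟨ ℕ-Solver.solve (i ∷ j ∷ []) ⟩
          i ℕ.+ (j ℕ.+ 1)  ≡⟨ i+[j+1] ⟩
          1 ℕ.* (2 ℕ.* m)  ∎

    -- Rotating by c ≡ −t turns the pairing j ↦ −2t − j of the terms of negCorr X (t + t)
    -- into u ↦ −u, whose fixed points 0 and m contribute y_t and y_{t+m}.
    private module Rotation (t c : ℕ) (c+t≡n : c ℕ.+ t ≡ 2 ℕ.* m) where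

      term rotated : ℕ → ℤ
      term j = y j * y (j ℕ.+ (t ℕ.+ t))
      rotated u = term (c ℕ.+ u)

      term-periodic : ∀ j → term (2 ℕ.* m ℕ.+ j) ≡ term j
      term-periodic j =
        cong₂ _*_ (neg-n+ X j) (trans (cong y (ℕₚ.+-assoc (2 ℕ.* m) j (t ℕ.+ t))) (neg-n+ X (j ℕ.+ (t ℕ.+ t))))

      opposite : ∀ i j → i ℕ.+ j ≡ 2 ℕ.* m → c ℕ.+ i ℕ.+ (c ℕ.+ j ℕ.+ (t ℕ.+ t)) ≡ 3 ℕ.* (2 ℕ.* m)
      opposite i j i+j≡n = begin
        c ℕ.+ i ℕ.+ (c ℕ.+ j ℕ.+ (t ℕ.+ t))      ≡⟨ ℕ-Solver.solve (c ∷ i ∷ j ∷ t ∷ []) ⟩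
        c ℕ.+ t ℕ.+ (c ℕ.+ t) ℕ.+ (i ℕ.+ j)      ≡⟨ cong₂ (λ a b → a ℕ.+ a ℕ.+ b) c+t≡n i+j≡n ⟩
        2 ℕ.* m ℕ.+ 2 ℕ.* m ℕ.+ 2 ℕ.* m          ≡⟨ ℕ-Solver.solve (m ∷ []) ⟩
        3 ℕ.* (2 ℕ.* m)                          ∎
        where open ≡-Reasoning

      rotated-mirror : ∀ i j → i ℕ.+ j ≡ 2 ℕ.* m → rotated i ≡ rotated j
      rotated-mirror i j i+j≡n = trans
        (cong₂ _*_ (neg-reflect X X-sym 3 (opposite i j i+j≡n))
                   (neg-reflect X X-sym 3 (trans (ℕₚ.+-comm (c ℕ.+ i ℕ.+ (t ℕ.+ t)) (c ℕ.+ j)) (opposite j i (trans (ℕₚ.+-comm j i) i+j≡n)))))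
        (*-comm (y (c ℕ.+ j ℕ.+ (t ℕ.+ t))) (y (c ℕ.+ j)))

      rotated-0 : rotated 0 ≡ y t
      rotated-0 = trans (cong₂ _*_ (neg-reflect X X-sym 1 opposite-t) (neg-periodic X 1 shifted-t)) (neg-idem X t)
        where
        open ≡-Reasoning
        opposite-t : c ℕ.+ 0 ℕ.+ t ≡ 1 ℕ.* (2 ℕ.* m)
        opposite-t = begin
          c ℕ.+ 0 ℕ.+ t    ≡⟨ ℕ-Solver.solve (c ∷ t ∷ []) ⟩
          c ℕ.+ t          ≡⟨ c+t≡n ⟩
          2 ℕ.* m          ≡⟨ ℕₚ.*-identityˡ (2 ℕ.* m) ⟨
          1 ℕ.* (2 ℕ.* m)  ∎
        shifted-t : c ℕ.+ 0 ℕ.+ (t ℕ.+ t) ≡ t ℕ.+ 1 ℕ.* (2 ℕ.* m)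
        shifted-t = begin
          c ℕ.+ 0 ℕ.+ (t ℕ.+ t)    ≡⟨ ℕ-Solver.solve (c ∷ t ∷ []) ⟩
          t ℕ.+ (c ℕ.+ t)          ≡⟨ cong (t ℕ.+_) c+t≡n ⟩
          t ℕ.+ 2 ℕ.* m            ≡⟨ ℕ-Solver.solve (t ∷ m ∷ []) ⟩
          t ℕ.+ 1 ℕ.* (2 ℕ.* m)    ∎

      rotated-m : rotated m ≡ y (t ℕ.+ m)
      rotated-m = trans (cong₂ _*_ (neg-reflect X X-sym 2 opposite-t+m) (neg-periodic X 1 shifted-t+m)) (neg-idem X (t ℕ.+ m))
        where
        open ≡-Reasoning
        opposite-t+m : c ℕ.+ m ℕ.+ (t ℕ.+ m) ≡ 2 ℕ.* (2 ℕ.* m)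
        opposite-t+m = begin
          c ℕ.+ m ℕ.+ (t ℕ.+ m)      ≡⟨ ℕ-Solver.solve (c ∷ m ∷ t ∷ []) ⟩
          c ℕ.+ t ℕ.+ (m ℕ.+ m)      ≡⟨ cong (ℕ._+ (m ℕ.+ m)) c+t≡n ⟩
          2 ℕ.* m ℕ.+ (m ℕ.+ m)      ≡⟨ ℕ-Solver.solve (m ∷ []) ⟩
          2 ℕ.* (2 ℕ.* m)            ∎
        shifted-t+m : c ℕ.+ m ℕ.+ (t ℕ.+ t) ≡ t ℕ.+ m ℕ.+ 1 ℕ.* (2 ℕ.* m)
        shifted-t+m = begin
          c ℕ.+ m ℕ.+ (t ℕ.+ t)          ≡⟨ ℕ-Solver.solve (c ∷ m ∷ t ∷ []) ⟩
          t ℕ.+ m ℕ.+ (c ℕ.+ t)          ≡⟨ cong (t ℕ.+ m ℕ.+_) c+t≡n ⟩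
          t ℕ.+ m ℕ.+ 2 ℕ.* m            ≡⟨ ℕ-Solver.solve (t ∷ m ∷ []) ⟩
          t ℕ.+ m ℕ.+ 1 ℕ.* (2 ℕ.* m)    ∎

    negCorr-double≡negPair : ∀ t c → c ℕ.+ t ≡ 2 ℕ.* m → + 2 ∣ negCorr X (t ℕ.+ t) - negPair m X t
    negCorr-double≡negPair t c c+t≡n = c+a≡2p+b⇒2∣c-[a+b] (negCorr X (t ℕ.+ t)) (y t) (y (t ℕ.+ m)) (sumTo m rotated) $ begin
      sumTo (2 ℕ.* m) term + y t                   ≡⟨ cong₂ _+_ (sumTo-rotate (2 ℕ.* m) term term-periodic c) rotated-0 ⟨
      sumTo (2 ℕ.* m) rotated + rotated 0          ≡⟨ sumTo-mirror m rotated rotated-mirror ⟩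
      + 2 * sumTo m rotated + rotated m            ≡⟨ cong (λ z → + 2 * sumTo m rotated + z) rotated-m ⟩
      + 2 * sumTo m rotated + y (t ℕ.+ m)          ∎
      where
      open ≡-Reasoning
      open Rotation t c c+t≡n

  module Quadruple {m : ℕ} .{{_ : NonZero m}} (A B C D : Seq (2 ℕ.* m))
                   (W : IsWilliamson (2 ℕ.* m) A B C D) where

    total : (Seq (2 ℕ.* m) → ℤ) → ℤ
    total f = f A + f B + f C + f D

    total-∣ : ∀ {d} (f : Seq (2 ℕ.* m) → ℤ) → (∀ (X : Seq (2 ℕ.* m)) → IsPM1 X → Symmetric X → d ∣ f X) → d ∣ total f
    total-∣ f d∣f =
      let ((pA , pB , pC , pD) , (sA , sB , sC , sD) , _) = W
      in ∣m∣n⇒∣m+n (∣m∣n⇒∣m+n (∣m∣n⇒∣m+n (d∣f A pA sA) (d∣f B pB sB)) (d∣f C pC sC)) (d∣f D pD sD)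

    total-cong : ∀ (f g : Seq (2 ℕ.* m) → ℤ) → (∀ (X : Seq (2 ℕ.* m)) → IsPM1 X → Symmetric X → f X ≡ g X) → total f ≡ total g
    total-cong f g f≗g =
      let ((pA , pB , pC , pD) , (sA , sB , sC , sD) , _) = W
      in cong₂ _+_ (cong₂ _+_ (cong₂ _+_ (f≗g A pA sA) (f≗g B pB sB)) (f≗g C pC sC)) (f≗g D pD sD)

    private
      2∣n : + 2 ∣ + (2 ℕ.* m)
      2∣n = divides (+ m) (trans (pos-* 2 m) (*-comm (+ 2) (+ m)))

      n/2≡m : 2 ℕ.* m / 2 ≡ m
      n/2≡m = trans (cong (_/ 2) (ℕₚ.*-comm 2 m)) (m*n/n≡m m 2)

    total-negCorr : ∀ s → 1 ℕ.≤ s → s ℕ.≤ m → total (λ X → negCorr X s) + + (2 ℕ.* m) ≡ total negCount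
    total-negCorr s 1≤s s≤m = *-cancelˡ-≡ (+ 4) _ _ $ begin
      + 4 * (total (λ X → negCorr X s) + + (2 ℕ.* m))
        ≡⟨ distribute (+ (2 ℕ.* m)) (negCorr A s) (negCorr B s) (negCorr C s) (negCorr D s) ⟩
      total (λ X → + (2 ℕ.* m) + + 4 * negCorr X s)
        ≡⟨ total-cong _ _ (λ X X-pm _ → PAF-via-negCorr X X-pm s) ⟨
      total (λ X → PAF X s + + 4 * negCount X)
        ≡⟨ collect (PAF A s) (PAF B s) (PAF C s) (PAF D s) (negCount A) (negCount B) (negCount C) (negCount D) ⟩
      PAF A s + PAF B s + PAF C s + PAF D s + + 4 * total negCount
        ≡⟨ cong (λ z → z + + 4 * total negCount) (proj₂ (proj₂ W) s 1≤s (subst (s ℕ.≤_) (sym n/2≡m) s≤m)) ⟩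
      + 0 + + 4 * total negCount
        ≡⟨ +-identityˡ _ ⟩
      + 4 * total negCount
        ∎
      where
      open ≡-Reasoning
      distribute : ∀ N a b c d → + 4 * (a + b + c + d + N) ≡ (N + + 4 * a) + (N + + 4 * b) + (N + + 4 * c) + (N + + 4 * d)
      distribute = solve-∀
      collect : ∀ p q r u a b c d → (p + + 4 * a) + (q + + 4 * b) + (r + + 4 * c) + (u + + 4 * d) ≡ p + q + r + u + + 4 * (a + b + c + d)
      collect = solve-∀

    total-negCount-even : + 2 ∣ total negCount
    total-negCount-even = subst (+ 2 ∣_) (total-negCorr 1 ℕₚ.≤-refl (ℕ.>-nonZero⁻¹ m))
      (∣m∣n⇒∣m+n (total-∣ _ (λ X _ X-sym → negCorr-1-even X X-sym)) 2∣n)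

    total-negCorr-double-even : ∀ t → t ℕ.+ t ℕ.≤ m → + 2 ∣ total (λ X → negCorr X (t ℕ.+ t))
    total-negCorr-double-even zero    _    = subst (+ 2 ∣_) (sym (total-cong _ _ (λ X _ _ → negCorr-0 X))) total-negCount-even
    total-negCorr-double-even (suc t) 2t≤m =
      ∣m+n∣n⇒∣m (subst (+ 2 ∣_) (sym (total-negCorr (suc t ℕ.+ suc t) (s≤s z≤n) 2t≤m)) total-negCount-even) 2∣n

    total-negPair-even-≤ : ∀ t → t ℕ.+ t ℕ.≤ m → + 2 ∣ total (λ X → negPair m X t)
    total-negPair-even-≤ t 2t≤m =
      subst (+ 2 ∣_) (cancel (negCorr A (t ℕ.+ t)) (negCorr B (t ℕ.+ t)) (negCorr C (t ℕ.+ t)) (negCorr D (t ℕ.+ t))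
                             (negPair m A t) (negPair m B t) (negPair m C t) (negPair m D t))
        (∣m∣n⇒∣m-n (total-negCorr-double-even t 2t≤m) differences-even)
      where
      t≤n : t ℕ.≤ 2 ℕ.* m
      t≤n = ℕₚ.≤-trans (ℕₚ.m≤m+n t t) (ℕₚ.≤-trans 2t≤m (ℕₚ.m≤m+n m (m ℕ.+ 0)))
      differences-even : + 2 ∣ total (λ X → negCorr X (t ℕ.+ t) - negPair m X t)
      differences-even = total-∣ _ (λ X _ X-sym → negCorr-double≡negPair X X-sym t (2 ℕ.* m ℕ.∸ t) (ℕₚ.m∸n+n≡m t≤n))
      cancel : ∀ a b c d p q r u → a + b + c + d - ((a - p) + (b - q) + (c - r) + (d - u)) ≡ p + q + r + u
      cancel = solve-∀

    total-negPair-even : ∀ t → t ℕ.< m → + 2 ∣ total (λ X → negPair m X t)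
    total-negPair-even t t<m with t ℕ.+ t ℕ.≤? m
    ... | yes 2t≤m = total-negPair-even-≤ t 2t≤m
    ... | no  2t≰m = subst (+ 2 ∣_) (total-cong _ _ (λ X _ X-sym → negPair-reflect X X-sym u+t≡m)) (total-negPair-even-≤ u 2u≤m)
      where
      u : ℕ
      u = m ℕ.∸ t
      u+t≡m : u ℕ.+ t ≡ m
      u+t≡m = ℕₚ.m∸n+n≡m (ℕₚ.<⇒≤ t<m)
      u<t : u ℕ.< t
      u<t = ℕₚ.+-cancelʳ-< t u t (subst (ℕ._< t ℕ.+ t) (sym u+t≡m) (ℕₚ.≰⇒> 2t≰m))
      2u≤m : u ℕ.+ u ℕ.≤ m
      2u≤m = subst (u ℕ.+ u ℕ.≤_) u+t≡m (ℕₚ.+-monoʳ-≤ u (ℕₚ.<⇒≤ u<t))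

    total-compress2-divisible : ∀ j → + 4 ∣ total (λ X → compress2 m X j)
    total-compress2-divisible j = subst (+ 4 ∣_) (sym compress2-total)
      (*-monoʳ-∣ (+ 2) (∣m∣n⇒∣m-n (divides (+ 2) refl) (total-negPair-even (toℕ j) (toℕ<n j))))
      where
      factor : ∀ a b c d → (+ 2 - + 2 * a) + (+ 2 - + 2 * b) + (+ 2 - + 2 * c) + (+ 2 - + 2 * d) ≡ + 2 * (+ 4 - (a + b + c + d))
      factor = solve-∀
      compress2-total : total (λ X → compress2 m X j) ≡ + 2 * (+ 4 - total (λ X → negPair m X (toℕ j)))
      compress2-total = trans (total-cong _ _ (λ X X-pm _ → compress2-via-negPair X X-pm j))
                              (factor (negPair m A (toℕ j)) (negPair m B (toℕ j)) (negPair m C (toℕ j)) (negPair m D (toℕ j)))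

open import Data.Nat using (ℕ; suc; _*_)
open import Data.Fin using (Fin)
open import Data.Integer using (+_; _+_)
open import Data.Integer.Divisibility using (_∣_)
open import Data.Integer.Divisibility.Signed using (∣⇒∣ᵤ)
open WilliamsonParity using (module Quadruple)

corollary4 : (k : ℕ) → (A B C D : Seq (2 * suc k))
    → IsWilliamson (2 * suc k) A B C D
    → (j : Fin (suc k))
    → (+ 4) ∣ (compress2 (suc k) A j + compress2 (suc k) B j + compress2 (suc k) C j + compress2 (suc k) D j)
corollary4 k A B C D W j = ∣⇒∣ᵤ (total-compress2-divisible j)
  where open Quadruple A B C D W
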